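{- Let $G$ be the grid defined in the context. For every $i\ge0$, $[G(i,0)]_3\le[G(i,j)]_3$ for all $j\ge0$ (the smallest base-3 value in row $i$ is attained in column $0$). Moreover, $[G(j,0)]_3<[G(i,0)]_3$ whenever $0\le j<i$.
   Context: For a finite string $w=a_na_{n-1}\cdots a_0$ over digits $\{0,1,2\}$ let $[w]_{3/2}=\sum_k a_k(3/2)^k$ and $[w]_3=\sum_k a_k3^k$. Define an operation $T$ on such strings ("adding 2 in base $\frac32$"): if $w$ contains no digit $0$, first replace $w$ by $0w$; then change the rightmost $0$ of $w$ into $2$, change every digit to the right of it by $1\mapsto0$, $2\mapsto1$, and leave all digits to the left of it unchanged. Then $[T(w)]_{3/2}=[w]_{3/2}+2$. The grid $G$ has entries $G(i,j)$ (row $i$, column $j$, $i,j\ge0$): $G(0,j)$ is the binary representation of $j$ (so row $0$ is $0,1,10,11,100,\dots$), and $G(i+1,j)=T(G(i,j))$. -}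

module Defs where

open import Data.Nat using (ℕ; zero; suc; _+_; _*_)
open import Data.Nat.DivMod using (_/_; _%_)
open import Data.List using (List; []; _∷_; _++_)
open import Data.Maybe using (Maybe; just; nothing)

data Digit : Set where
  d0 d1 d2 : Digit

digitVal : Digit → ℕ
digitVal d0 = 0
digitVal d1 = 1
digitVal d2 = 2

-- A digit string w = a_n ... a_0 is represented as a list with the LEAST
-- significant digit first: a_0 ∷ a_1 ∷ ... ∷ a_n ∷ [].
-- So "rightmost" in the paper = closest to the head of the list, and
-- prepending a digit on the left (0w) = appending at the end of the list.
DigitString : Set
DigitString = List Digit

val3 : DigitString → ℕ
val3 []       = 0
val3 (a ∷ w)  = digitVal a + 3 * val3 w

-- Step of T once the string is known to contain a 0: change the rightmost 0
-- into 2, decrement (1↦0, 2↦1) every digit to its right; returns nothing if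
-- there is no 0.
step : DigitString → Maybe DigitString
step []        = nothing
step (d0 ∷ w)  = just (d2 ∷ w)
step (d1 ∷ w)  with step w
... | just w'  = just (d0 ∷ w')
... | nothing  = nothing
step (d2 ∷ w)  with step w
... | just w'  = just (d1 ∷ w')
... | nothing  = nothing

T : DigitString → DigitString
T w with step w
... | just w'  = w'
... | nothing with step (w ++ (d0 ∷ []))
...   | just w'' = w''
...   | nothing  = []   -- unreachable: w ++ [0] always contains a 0

-- binary representation of j (least significant digit first), no leading
-- zeros; 0 ↦ "0".  bits fuel n produces the binary digits of n as long as
-- fuel ≥ n (fuel j suffices for j).
bitOf : ℕ → Digit
bitOf zero = d0
bitOf (suc _) = d1

bits : ℕ → ℕ → DigitString
bits zero       _       = []
bits (suc f)    zero    = []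
bits (suc f)    (suc n) = bitOf (suc n % 2) ∷ bits f (suc n / 2)

binary : ℕ → DigitString
binary zero    = d0 ∷ []
binary (suc n) = bits (suc n) (suc n)

G : ℕ → ℕ → DigitString
G zero    j = binary j
G (suc i) j = T (G i j)

module Submission where

-- On the least-significant-first representation, T is the
-- structural recursion  add2  ("add 2 in base 3/2"), so G i j = add2ⁱ (binary j).
-- Applying add2 strictly increases the base-3 value.  After n additions the
-- lowest digit r and the carry c into the tail satisfy
--   add2ⁿ (a ∷ w) = r ∷ add2ᶜ w,   r + 3c = a + 2n.
-- Call (x , y) monotone if n ≤ m implies [add2ⁿ x]₃ ≤ [add2ᵐ y]₃; then n < m
-- gives strict inequality.  Comparing lowest digits and carries in base 3
-- shows that monotonicity passes from tails x, y to a ∷ x, b ∷ y when a ≤ b;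
-- by induction on y the empty string is monotone against every y, hence so
-- is "0" against every nonempty string, in particular every binary numeral.
-- Both parts of the theorem are instances of this for the pair ("0", binary j).

open import Defs
open import Data.Nat using (ℕ; zero; suc; _+_; _*_; _∸_; _≤_; _<_; z≤n; s≤s)
open import Data.Nat.Properties
open import Data.Nat.GeneralisedArithmetic using (fold; fold-+)
open import Data.Nat.Tactic.RingSolver using (solve-∀)
open import Data.Product using (_×_; _,_; Σ)
open import Data.Sum using (_⊎_; inj₁; inj₂)
open import Data.Empty using (⊥-elim)
open import Data.List using ([]; _∷_; _++_)
open import Data.Maybe using (just; nothing)
open import Relation.Binary using (tri<; tri≈; tri>)
open import Relation.Binary.PropositionalEquality

-- Adding 2 in base 3/2, by recursion from the least significant digit:
-- a 0 becomes 2 and stops, a 1 or 2 is lowered by one and the recursion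
-- continues; on the empty string this creates the new leading 0 ↦ 2.
add2 : DigitString → DigitString
add2 []       = d2 ∷ []
add2 (d0 ∷ w) = d2 ∷ w
add2 (d1 ∷ w) = d0 ∷ add2 w
add2 (d2 ∷ w) = d1 ∷ add2 w

add2^ : ℕ → DigitString → DigitString
add2^ n w = fold w add2 n

step-add2 : ∀ w → step w ≡ just (add2 w)
                ⊎ (step w ≡ nothing × step (w ++ d0 ∷ []) ≡ just (add2 w))
step-add2 []       = inj₂ (refl , refl)
step-add2 (d0 ∷ w) = inj₁ refl
step-add2 (d1 ∷ w) with step-add2 w
... | inj₁ e         rewrite e       = inj₁ refl
... | inj₂ (e₁ , e₂) rewrite e₁ | e₂ = inj₂ (refl , refl)
step-add2 (d2 ∷ w) with step-add2 w
... | inj₁ e         rewrite e       = inj₁ refl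
... | inj₂ (e₁ , e₂) rewrite e₁ | e₂ = inj₂ (refl , refl)

T≡add2 : ∀ w → T w ≡ add2 w
T≡add2 w with step-add2 w
... | inj₁ e         rewrite e       = refl
... | inj₂ (e₁ , e₂) rewrite e₁ | e₂ = refl

G≡add2^ : ∀ i j → G i j ≡ add2^ i (binary j)
G≡add2^ zero    j = refl
G≡add2^ (suc i) j = trans (T≡add2 (G i j)) (cong add2 (G≡add2^ i j))

digitVal≤2 : ∀ a → digitVal a ≤ 2
digitVal≤2 d0 = z≤n
digitVal≤2 d1 = s≤s z≤n
digitVal≤2 d2 = s≤s (s≤s z≤n)

add2-increasing : ∀ w → val3 w < val3 (add2 w)
add2-increasing []       = s≤s z≤n
add2-increasing (d0 ∷ w) = s≤s (n≤1+n _)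
add2-increasing (d1 ∷ w) = begin-strict
  1 + 3 * val3 w          <⟨ +-monoˡ-< (3 * val3 w) {1} {3} (s≤s (s≤s z≤n)) ⟩
  3 + 3 * val3 w          ≡⟨ sym (*-suc 3 (val3 w)) ⟩
  3 * suc (val3 w)        ≤⟨ *-monoʳ-≤ 3 (add2-increasing w) ⟩
  0 + 3 * val3 (add2 w)   ∎
  where open ≤-Reasoning
add2-increasing (d2 ∷ w) = begin-strict
  2 + 3 * val3 w          <⟨ n<1+n _ ⟩
  3 + 3 * val3 w          ≡⟨ sym (*-suc 3 (val3 w)) ⟩
  3 * suc (val3 w)        ≤⟨ *-monoʳ-≤ 3 (add2-increasing w) ⟩
  3 * val3 (add2 w)       ≤⟨ n≤1+n _ ⟩
  1 + 3 * val3 (add2 w)   ∎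
  where open ≤-Reasoning

Monotone : DigitString → DigitString → Set
Monotone x y = ∀ {n m} → n ≤ m → val3 (add2^ n x) ≤ val3 (add2^ m y)

-- Weak monotonicity upgrades to strict monotonicity, since the extra
-- iteration on the right strictly increases the value.
strictly : ∀ {x y} → Monotone x y → ∀ {n m} → n < m →
           val3 (add2^ n x) < val3 (add2^ m y)
strictly {y = y} mono {m = suc k} (s≤s n≤k) =
  ≤-trans (s≤s (mono n≤k)) (add2-increasing (add2^ k y))

add2^-monotone : ∀ w → Monotone w w
add2^-monotone w {n} {m} n≤m =
  subst (λ k → val3 (add2^ n w) ≤ val3 (add2^ k w)) (m∸n+n≡m n≤m) (grow (m ∸ n))
  where
  grow : ∀ k → val3 (add2^ n w) ≤ val3 (add2^ (k + n) w)
  grow zero    = ≤-refl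
  grow (suc k) = ≤-trans (grow k) (<⇒≤ (add2-increasing (add2^ (k + n) w)))

add2-cons : ∀ r w → Σ Digit λ r' → Σ ℕ λ k →
            add2 (r ∷ w) ≡ r' ∷ add2^ k w × digitVal r' + 3 * k ≡ digitVal r + 2
add2-cons d0 w = d2 , 0 , refl , refl
add2-cons d1 w = d0 , 1 , refl , refl
add2-cons d2 w = d1 , 1 , refl , refl

lowest-digit : ∀ a w n → Σ Digit λ r → Σ ℕ λ c →
               add2^ n (a ∷ w) ≡ r ∷ add2^ c w × digitVal r + 3 * c ≡ digitVal a + 2 * n
lowest-digit a w zero = a , 0 , refl , refl
lowest-digit a w (suc n) with lowest-digit a w n
... | r , c , e , h with add2-cons r (add2^ c w)
...   | r' , k , e' , h' = r' , k + c , string , value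
  where
  open ≡-Reasoning
  string : add2^ (suc n) (a ∷ w) ≡ r' ∷ add2^ (k + c) w
  string = begin
    add2 (add2^ n (a ∷ w))     ≡⟨ cong add2 e ⟩
    add2 (r ∷ add2^ c w)       ≡⟨ e' ⟩
    r' ∷ add2^ k (add2^ c w)   ≡⟨ cong (r' ∷_) (sym (fold-+ w add2 k)) ⟩
    r' ∷ add2^ (k + c) w       ∎
  value : digitVal r' + 3 * (k + c) ≡ digitVal a + 2 * suc n
  value = begin
    digitVal r' + 3 * (k + c)        ≡⟨ cong (digitVal r' +_) (*-distribˡ-+ 3 k c) ⟩
    digitVal r' + (3 * k + 3 * c)    ≡⟨ sym (+-assoc (digitVal r') (3 * k) (3 * c)) ⟩
    digitVal r' + 3 * k + 3 * c      ≡⟨ cong (_+ 3 * c) h' ⟩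
    digitVal r + 2 + 3 * c           ≡⟨ shift-2 (digitVal r) (3 * c) ⟩
    digitVal r + 3 * c + 2           ≡⟨ cong (_+ 2) h ⟩
    digitVal a + 2 * n + 2           ≡⟨ twice-suc (digitVal a) n ⟩
    digitVal a + 2 * suc n           ∎
    where
    shift-2 : ∀ x y → x + 2 + y ≡ x + y + 2
    shift-2 = solve-∀
    twice-suc : ∀ x n → x + 2 * n + 2 ≡ x + 2 * suc n
    twice-suc = solve-∀

below-next-multiple : ∀ {r} V → r ≤ 2 → r + 3 * V < 3 * suc V
below-next-multiple {r} V r≤2 = begin-strict
  r + 3 * V     <⟨ s≤s (+-monoˡ-≤ (3 * V) r≤2) ⟩
  3 + 3 * V     ≡⟨ sym (*-suc 3 V) ⟩
  3 * suc V     ∎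
  where open ≤-Reasoning

base3-compare : ∀ {r r' c c' V V'} → r ≤ 2 → r' ≤ 2 → r + 3 * c ≤ r' + 3 * c' →
                (c ≡ c' → V ≤ V') → (c < c' → V < V') → r + 3 * V ≤ r' + 3 * V'
base3-compare {r} {r'} {c} {c'} {V} {V'} r≤2 r'≤2 low same less with <-cmp c c'
... | tri< c<c' _ _ = begin
  r + 3 * V     ≤⟨ <⇒≤ (below-next-multiple V r≤2) ⟩
  3 * suc V     ≤⟨ *-monoʳ-≤ 3 (less c<c') ⟩
  3 * V'        ≤⟨ m≤n+m (3 * V') r' ⟩
  r' + 3 * V'   ∎
  where open ≤-Reasoning
... | tri≈ _ refl _ = +-mono-≤ (+-cancelʳ-≤ (3 * c) r r' low) (*-monoʳ-≤ 3 (same refl))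
... | tri> _ _ c'<c = ⊥-elim (<-irrefl refl (begin-strict
  r' + 3 * c'   <⟨ below-next-multiple c' r'≤2 ⟩
  3 * suc c'    ≤⟨ *-monoʳ-≤ 3 c'<c ⟩
  3 * c         ≤⟨ m≤n+m (3 * c) r ⟩
  r + 3 * c     ≤⟨ low ⟩
  r' + 3 * c'   ∎))
  where open ≤-Reasoning

-- With n ≤ m the lowest digits and
-- carries satisfy r + 3c = a + 2n ≤ b + 2m = r' + 3c', and the tails are
-- compared by (strict) monotonicity of (x , y) in the carries.
cons-monotone : ∀ {a b x y} → digitVal a ≤ digitVal b → Monotone x y →
                Monotone (a ∷ x) (b ∷ y)
cons-monotone {a} {b} {x} {y} a≤b mono {n} {m} n≤m
  with lowest-digit a x n | lowest-digit b y m
... | r , c , e , h | r' , c' , e' , h' rewrite e | e' =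
  base3-compare {c = c} {c'} (digitVal≤2 r) (digitVal≤2 r') carries
    (λ { refl → mono {c} ≤-refl }) (strictly mono)
  where
  open ≤-Reasoning
  carries : digitVal r + 3 * c ≤ digitVal r' + 3 * c'
  carries = begin
    digitVal r + 3 * c     ≡⟨ h ⟩
    digitVal a + 2 * n     ≤⟨ +-mono-≤ a≤b (*-monoʳ-≤ 2 n≤m) ⟩
    digitVal b + 2 * m     ≡⟨ sym h' ⟩
    digitVal r' + 3 * c'   ∎

add2^-leading-zero : ∀ n → add2^ (suc n) [] ≡ add2^ (suc n) (d0 ∷ [])
add2^-leading-zero zero    = refl
add2^-leading-zero (suc n) = cong add2 (add2^-leading-zero n)

val3-leading-zero : ∀ n → val3 (add2^ n []) ≡ val3 (add2^ n (d0 ∷ []))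
val3-leading-zero zero    = refl
val3-leading-zero (suc n) = cong val3 (add2^-leading-zero n)

-- The empty string (value 0) is monotone against every string y; for a
-- nonempty y, replace [] by "0" and apply cons-monotone with 0 ≤ b.
empty-monotone : ∀ y → Monotone [] y
empty-monotone []      = add2^-monotone []
empty-monotone (b ∷ y) {n} {m} n≤m =
  subst (_≤ val3 (add2^ m (b ∷ y))) (sym (val3-leading-zero n))
        (cons-monotone z≤n (empty-monotone y) n≤m)

zero-below-nonempty : ∀ b y → Monotone (d0 ∷ []) (b ∷ y)
zero-below-nonempty b y = cons-monotone z≤n (empty-monotone y)

zero-below-binary : ∀ j → Monotone (d0 ∷ []) (binary j)
zero-below-binary zero    = zero-below-nonempty _ _
zero-below-binary (suc j) = zero-below-nonempty _ _

lemma9 : ((i j : ℕ) → val3 (G i 0) ≤ val3 (G i j))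
         × ((i j : ℕ) → j < i → val3 (G j 0) < val3 (G i 0))
lemma9 = row-minimum , column-increasing
  where
  row-minimum : (i j : ℕ) → val3 (G i 0) ≤ val3 (G i j)
  row-minimum i j = subst₂ _≤_ (cong val3 (sym (G≡add2^ i 0))) (cong val3 (sym (G≡add2^ i j)))
                      (zero-below-binary j {i} ≤-refl)
  column-increasing : (i j : ℕ) → j < i → val3 (G j 0) < val3 (G i 0)
  column-increasing i j j<i = subst₂ _<_ (cong val3 (sym (G≡add2^ j 0))) (cong val3 (sym (G≡add2^ i 0)))
                                (strictly (zero-below-binary 0) j<i)
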